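{- Let $n\ge 3$ and $m\ge 1$, and let $\overline{K_m}$ denote the edgeless graph on $m$ vertices. Then $$\chi_{\text{so}}(C_n\vee \overline{K_m})=\begin{cases}\chi_{\text{so}}(W_n), & \text{if } m \text{ is odd},\\ \chi_{\text{so}}(W_n)+1, & \text{if } m \text{ is even},\end{cases}$$ where $W_n=C_n\vee K_1$ is the wheel graph.
   Context: All graphs are finite and simple. A strong odd coloring of a graph $G$ is a proper vertex coloring of $G$ such that for every vertex $v$ and every color $c$, the number of neighbors of $v$ colored $c$ is either $0$ or odd. The strong odd chromatic number $\chi_{\text{so}}(G)$ is the minimum number of colors in a strong odd coloring of $G$. The join $G_1\vee G_2$ is obtained from disjoint copies of $G_1$ and $G_2$ by adding all edges between $V(G_1)$ and $V(G_2)$; $C_n$ is the cycle on $n$ vertices. -}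

module Defs where

open import Data.Nat using (ℕ; zero; suc; _+_; _≤_; _%_; _≡ᵇ_)
open import Data.Bool using (Bool; true; false; _∨_; _∧_; if_then_else_)
open import Data.Fin using (Fin; toℕ; splitAt)
open import Data.Sum using (_⊎_; inj₁; inj₂)
open import Data.Product using (Σ; _×_)
open import Relation.Binary.PropositionalEquality using (_≡_; _≢_)

-- A graph on vertex set Fin v, given by a Boolean adjacency function.
-- (All concrete graphs below are simple: symmetric and loopless.)
Graph : ℕ → Set
Graph v = Fin v → Fin v → Bool

count : ∀ {v} → (Fin v → Bool) → ℕ
count {zero}  p = 0
count {suc v} p = (if p Fin.zero then 1 else 0) + count (λ i → p (Fin.suc i))

Odd : ℕ → Set
Odd k = k % 2 ≡ 1

nbrsColoured : ∀ {v k} → Graph v → (Fin v → Fin k) → Fin v → Fin k → ℕ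
nbrsColoured G col x c = count (λ u → G x u ∧ (toℕ (col u) ≡ᵇ toℕ c))

IsStrongOddColoring : ∀ {v} → Graph v → (k : ℕ) → (Fin v → Fin k) → Set
IsStrongOddColoring G k col =
  (∀ x y → G x y ≡ true → col x ≢ col y) ×
  (∀ x c → nbrsColoured G col x c ≡ 0 ⊎ Odd (nbrsColoured G col x c))

HasStrongOddColoring : ∀ {v} → Graph v → ℕ → Set
HasStrongOddColoring {v} G k = Σ (Fin v → Fin k) (IsStrongOddColoring G k)

IsChiSo : ∀ {v} → Graph v → ℕ → Set
IsChiSo G k = HasStrongOddColoring G k × (∀ j → HasStrongOddColoring G j → k ≤ j)

-- the cycle C_n on vertices 0..n-1 (i ~ i+1 mod n); intended for n ≥ 3
Cycle : (n : ℕ) → Graph n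
Cycle n i j =
  (toℕ j ≡ᵇ suc (toℕ i)) ∨ (toℕ i ≡ᵇ suc (toℕ j)) ∨
  ((toℕ i ≡ᵇ 0) ∧ (suc (toℕ j) ≡ᵇ n)) ∨ ((toℕ j ≡ᵇ 0) ∧ (suc (toℕ i) ≡ᵇ n))

Edgeless : (m : ℕ) → Graph m
Edgeless m i j = false

Join : ∀ {a b} → Graph a → Graph b → Graph (a + b)
Join {a} G₁ G₂ i j with splitAt a i | splitAt a j
... | inj₁ x | inj₁ y = G₁ x y
... | inj₂ x | inj₂ y = G₂ x y
... | inj₁ _ | inj₂ _ = true
... | inj₂ _ | inj₁ _ = true

Wheel : (n : ℕ) → Graph (n + 1)
Wheel n = Join (Cycle n) (Edgeless 1)

{-# OPTIONS --safe #-}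
module Submission where

-- In G ∨ K̄_m every vertex of G sees all of K̄_m and vice versa. So, both sides being
-- nonempty, a colouring is strong odd iff its restriction α to G is a strong odd colouring
-- of G, the restriction β to K̄_m uses colours disjoint from those of α, and every colour
-- class of α and of β is empty or odd. For m = 1 the condition on β is vacuous: a colouring
-- of the wheel G ∨ K₁ is such an α plus one fresh hub colour. For odd m, giving all of K̄_m
-- the hub colour works. For even m, K̄_m cannot be monochromatic, and recolouring one apex
-- vertex with a new colour suffices. Conversely, keeping a single apex vertex turns a
-- colouring of G ∨ K̄_m into one of the wheel, and for even m the colour of another apex
-- vertex then becomes unused and can be deleted.

open import Defs
open import Data.Nat using (ℕ; zero; suc; _≤_; _+_; _%_; _≡ᵇ_; s≤s)
import Data.Nat.Properties as ℕ
open import Data.Bool using (Bool; true; false; _∧_; if_then_else_)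
open import Data.Bool.Properties using (∧-zeroʳ)
open import Data.Empty using (⊥-elim)
open import Data.Fin as Fin using (Fin; toℕ; splitAt; _↑ˡ_; _↑ʳ_; inject₁; fromℕ; punchOut)
open import Data.Fin.Properties
  using (_≟_; toℕ-injective; splitAt-↑ˡ; splitAt-↑ʳ; splitAt⁻¹-↑ˡ; splitAt⁻¹-↑ʳ;
         any?; all?; ¬∀⟶∃¬;
         inject₁-injective; fromℕ≢inject₁; punchIn-injective; punchIn-punchOut)
open import Data.Product using (Σ-syntax; ∃-syntax; _×_; _,_; proj₁; proj₂)
open import Data.Sum using (_⊎_; inj₁; inj₂)
open import Data.Vec.Functional using (_∷_; _++_)
open import Data.Vec.Functional.Properties using (lookup-++ˡ; lookup-++ʳ)
open import Function using (id; _∘_)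
open import Function.Definitions using (Injective)
open import Relation.Binary.PropositionalEquality
  using (_≡_; _≢_; _≗_; refl; sym; trans; cong; cong₂; subst)
open import Relation.Nullary using (yes; no; ¬_)
open import Relation.Nullary.Decidable using (dec-true; dec-false)

private variable
  v m k k′ : ℕ

count-cong : {p q : Fin v → Bool} → p ≗ q → count p ≡ count q
count-cong {zero}  p≗q = refl
count-cong {suc v} p≗q =
  cong₂ _+_ (cong (λ b → if b then 1 else 0) (p≗q Fin.zero)) (count-cong (p≗q ∘ Fin.suc))

count-false : {p : Fin v → Bool} → (∀ i → p i ≡ false) → count p ≡ 0
count-false {zero}  all-false = refl
count-false {suc v} all-false rewrite all-false Fin.zero = count-false (all-false ∘ Fin.suc)

count-true : {p : Fin v → Bool} → (∀ i → p i ≡ true) → count p ≡ v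
count-true {zero}  all-true = refl
count-true {suc v} all-true rewrite all-true Fin.zero = cong suc (count-true (all-true ∘ Fin.suc))

count-++ : ∀ v (p : Fin (v + m) → Bool) → count p ≡ count (p ∘ (_↑ˡ m)) + count (p ∘ (v ↑ʳ_))
count-++ zero    p = refl
count-++ (suc v) p = trans (cong ((if p Fin.zero then 1 else 0) +_) (count-++ v (p ∘ Fin.suc)))
                           (sym (ℕ.+-assoc (if p Fin.zero then 1 else 0) _ _))

sameColour : Fin k → Fin k → Bool
sameColour a b = toℕ a ≡ᵇ toℕ b

sameColour-≡ : {a b : Fin k} → a ≡ b → sameColour a b ≡ true
sameColour-≡ {a = a} {b} a≡b = dec-true (toℕ a ℕ.≟ toℕ b) (cong toℕ a≡b)

sameColour-≢ : {a b : Fin k} → a ≢ b → sameColour a b ≡ false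
sameColour-≢ {a = a} {b} a≢b = dec-false (toℕ a ℕ.≟ toℕ b) (a≢b ∘ toℕ-injective)

sameColour-injective : (f : Fin k → Fin k′) → Injective _≡_ _≡_ f →
                       ∀ a b → sameColour (f a) (f b) ≡ sameColour a b
sameColour-injective f f-inj a b with a ≟ b
... | yes refl = trans (sameColour-≡ {a = f a} refl) (sym (sameColour-≡ {a = a} refl))
... | no a≢b   = trans (sameColour-≢ (a≢b ∘ f-inj)) (sym (sameColour-≢ a≢b))

-- nbrsColoured G col x is colouredIn (G x) col by definition, so the parity half of
-- IsStrongOddColoring G k col reads ∀ x → OddColourCounts (G x) col.
colouredIn : (Fin v → Bool) → (Fin v → Fin k) → Fin k → ℕ
colouredIn p col c = count (λ u → p u ∧ sameColour (col u) c)

classSize : (Fin v → Fin k) → Fin k → ℕ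
classSize = colouredIn (λ _ → true)

ZeroOrOdd : ℕ → Set
ZeroOrOdd n = n ≡ 0 ⊎ Odd n

OddColourCounts : (Fin v → Bool) → (Fin v → Fin k) → Set
OddColourCounts p col = ∀ c → ZeroOrOdd (colouredIn p col c)

OddColourClasses : (Fin v → Fin k) → Set
OddColourClasses = OddColourCounts (λ _ → true)

colouredIn-cong : {p q : Fin v → Bool} {col col′ : Fin v → Fin k} →
                  p ≗ q → col ≗ col′ → ∀ c → colouredIn p col c ≡ colouredIn q col′ c
colouredIn-cong p≗q col≗col′ c =
  count-cong (λ u → cong₂ _∧_ (p≗q u) (cong (λ a → sameColour a c) (col≗col′ u)))

colouredIn-unused : ∀ (p : Fin v → Bool) {col : Fin v → Fin k} {c} →
                    (∀ u → col u ≢ c) → colouredIn p col c ≡ 0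
colouredIn-unused p unused =
  count-false (λ u → trans (cong (p u ∧_) (sameColour-≢ (unused u))) (∧-zeroʳ (p u)))

colouredIn-nowhere : ∀ (col : Fin v → Fin k) c → colouredIn {v} (λ _ → false) col c ≡ 0
colouredIn-nowhere {v} col c = count-false {v} (λ _ → refl)

colouredIn-injective : ∀ (p : Fin v → Bool) {col : Fin v → Fin k} {f : Fin k → Fin k′} →
                       Injective _≡_ _≡_ f → ∀ c → colouredIn p (f ∘ col) (f c) ≡ colouredIn p col c
colouredIn-injective p {col} f-inj c =
  count-cong (λ u → cong (p u ∧_) (sameColour-injective _ f-inj (col u) c))

oddColourCounts-injective : ∀ {p : Fin v → Bool} {col : Fin v → Fin k} {f : Fin k → Fin k′} →
                            Injective _≡_ _≡_ f → OddColourCounts p col → OddColourCounts p (f ∘ col)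
oddColourCounts-injective {p = p} {col} {f} f-inj odd c with any? (λ c₀ → f c₀ ≟ c)
... | yes (c₀ , refl) = subst ZeroOrOdd (sym (colouredIn-injective p f-inj c₀)) (odd c₀)
... | no ∉image       = inj₁ (colouredIn-unused p (λ u fcolu≡c → ∉image (col u , fcolu≡c)))

oddColourCounts-reflect : ∀ {p : Fin v → Bool} {col : Fin v → Fin k} {col′ : Fin v → Fin k′} {f} →
                          Injective _≡_ _≡_ f → (∀ u → f (col′ u) ≡ col u) →
                          OddColourCounts p col → OddColourCounts p col′
oddColourCounts-reflect {p = p} {f = f} f-inj f∘col′≗col odd c =
  subst ZeroOrOdd (trans (colouredIn-cong (λ _ → refl) (sym ∘ f∘col′≗col) (f c))
                         (colouredIn-injective p f-inj c))
                  (odd (f c))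

isStrongOdd-injective : {G : Graph v} {col : Fin v → Fin k} {f : Fin k → Fin k′} →
                        Injective _≡_ _≡_ f →
                        IsStrongOddColoring G k col → IsStrongOddColoring G k′ (f ∘ col)
isStrongOdd-injective {G = G} f-inj (proper , odd) =
  (λ x y adj → proper x y adj ∘ f-inj) , (λ x → oddColourCounts-injective {p = G x} f-inj (odd x))

isStrongOdd-reflect : {G : Graph v} {col : Fin v → Fin k} {col′ : Fin v → Fin k′} {f : Fin k′ → Fin k} →
                      Injective _≡_ _≡_ f → (∀ u → f (col′ u) ≡ col u) →
                      IsStrongOddColoring G k col → IsStrongOddColoring G k′ col′
isStrongOdd-reflect {G = G} {f = f} f-inj f∘col′≗col (proper , odd) =
  (λ x y adj col′x≡col′y →
     proper x y adj (trans (sym (f∘col′≗col x)) (trans (cong f col′x≡col′y) (f∘col′≗col y)))) ,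
  (λ x → oddColourCounts-reflect {p = G x} f-inj f∘col′≗col (odd x))

dropUnusedColour : {G : Graph v} {col : Fin v → Fin (suc k)} → IsStrongOddColoring G (suc k) col →
                   ∀ b → (∀ u → col u ≢ b) → HasStrongOddColoring G k
dropUnusedColour soc b unused =
  (λ u → punchOut (unused u ∘ sym)) ,
  isStrongOdd-reflect (punchIn-injective b _ _) (λ u → punchIn-punchOut (unused u ∘ sym)) soc

↑-elim : ∀ (P : Fin (v + m) → Set) → (∀ x → P (x ↑ˡ m)) → (∀ e → P (v ↑ʳ e)) → ∀ u → P u
↑-elim {v} P left right u with splitAt v u in eq
... | inj₁ x = subst P (splitAt⁻¹-↑ˡ eq) (left x)
... | inj₂ e = subst P (splitAt⁻¹-↑ʳ eq) (right e)

module _ (G₁ : Graph v) (G₂ : Graph m) where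

  Join-↑ˡ-↑ˡ : ∀ x y → Join G₁ G₂ (x ↑ˡ m) (y ↑ˡ m) ≡ G₁ x y
  Join-↑ˡ-↑ˡ x y rewrite splitAt-↑ˡ v x m | splitAt-↑ˡ v y m = refl

  Join-↑ˡ-↑ʳ : ∀ x e → Join G₁ G₂ (x ↑ˡ m) (v ↑ʳ e) ≡ true
  Join-↑ˡ-↑ʳ x e rewrite splitAt-↑ˡ v x m | splitAt-↑ʳ v m e = refl

  Join-↑ʳ-↑ˡ : ∀ e x → Join G₁ G₂ (v ↑ʳ e) (x ↑ˡ m) ≡ true
  Join-↑ʳ-↑ˡ e x rewrite splitAt-↑ˡ v x m | splitAt-↑ʳ v m e = refl

  Join-↑ʳ-↑ʳ : ∀ e e′ → Join G₁ G₂ (v ↑ʳ e) (v ↑ʳ e′) ≡ G₂ e e′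
  Join-↑ʳ-↑ʳ e e′ rewrite splitAt-↑ʳ v m e | splitAt-↑ʳ v m e′ = refl

  colouredIn-Join-↑ˡ : ∀ (α : Fin v → Fin k) (β : Fin m → Fin k) x c →
    colouredIn (Join G₁ G₂ (x ↑ˡ m)) (α ++ β) c ≡ colouredIn (G₁ x) α c + classSize β c
  colouredIn-Join-↑ˡ α β x c = trans (count-++ v _)
    (cong₂ _+_ (colouredIn-cong (Join-↑ˡ-↑ˡ x) (lookup-++ˡ α β) c)
               (colouredIn-cong (Join-↑ˡ-↑ʳ x) (lookup-++ʳ α β) c))

  colouredIn-Join-↑ʳ : ∀ (α : Fin v → Fin k) (β : Fin m → Fin k) e c →
    colouredIn (Join G₁ G₂ (v ↑ʳ e)) (α ++ β) c ≡ classSize α c + colouredIn (G₂ e) β c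
  colouredIn-Join-↑ʳ α β e c = trans (count-++ v _)
    (cong₂ _+_ (colouredIn-cong (Join-↑ʳ-↑ˡ e) (lookup-++ˡ α β) c)
               (colouredIn-cong (Join-↑ʳ-↑ʳ e) (lookup-++ʳ α β) c))

record JoinColouring (G : Graph v) (m k : ℕ) (α : Fin v → Fin k) (β : Fin m → Fin k) : Set where
  field
    base-strongOdd : IsStrongOddColoring G k α
    base-classes   : OddColourClasses α
    apex-classes   : OddColourClasses β
    disjoint       : ∀ x e → α x ≢ β e
open JoinColouring

disjoint⇒unused : {α : Fin v → Fin k} {β : Fin m → Fin k} → (∀ x e → α x ≢ β e) →
                  ∀ c → (∀ x → α x ≢ c) ⊎ (∀ e → β e ≢ c)
disjoint⇒unused {α = α} disj c with any? (λ x → α x ≟ c)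
... | yes (x , refl) = inj₂ (λ e βe≡αx → disj x e (sym βe≡αx))
... | no ∄x          = inj₁ (λ x αx≡c → ∄x (x , αx≡c))

module _ {G : Graph v} {α : Fin v → Fin k} {β : Fin m → Fin k} where

  joinColouring⇒strongOdd : JoinColouring G m k α β → IsStrongOddColoring (Join G (Edgeless m)) k (α ++ β)
  joinColouring⇒strongOdd J = ↑-elim _ (λ x → ↑-elim _ (base-base x) (base-apex x))
                                       (λ e → ↑-elim _ (apex-base e) (apex-apex e))
                            , ↑-elim _ atBase atApex
    where
    Proper : Fin (v + m) → Fin (v + m) → Set
    Proper u w = Join G (Edgeless m) u w ≡ true → (α ++ β) u ≢ (α ++ β) w

    base-base : ∀ x y → Proper (x ↑ˡ m) (y ↑ˡ m)
    base-base x y rewrite Join-↑ˡ-↑ˡ G (Edgeless m) x y | lookup-++ˡ α β x | lookup-++ˡ α β y =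
      proj₁ (base-strongOdd J) x y

    base-apex : ∀ x e → Proper (x ↑ˡ m) (v ↑ʳ e)
    base-apex x e _ rewrite lookup-++ˡ α β x | lookup-++ʳ α β e = disjoint J x e

    apex-base : ∀ e x → Proper (v ↑ʳ e) (x ↑ˡ m)
    apex-base e x _ rewrite lookup-++ˡ α β x | lookup-++ʳ α β e = disjoint J x e ∘ sym

    apex-apex : ∀ e e′ → Proper (v ↑ʳ e) (v ↑ʳ e′)
    apex-apex e e′ rewrite Join-↑ʳ-↑ʳ G (Edgeless m) e e′ = λ ()

    atBase : ∀ x → OddColourCounts (Join G (Edgeless m) (x ↑ˡ m)) (α ++ β)
    atBase x c rewrite colouredIn-Join-↑ˡ G (Edgeless m) α β x c with disjoint⇒unused (disjoint J) c
    ... | inj₁ α-unused rewrite colouredIn-unused (G x) α-unused = apex-classes J c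
    ... | inj₂ β-unused rewrite colouredIn-unused (λ _ → true) β-unused
                              | ℕ.+-identityʳ (colouredIn (G x) α c) = proj₂ (base-strongOdd J) x c

    atApex : ∀ e → OddColourCounts (Join G (Edgeless m) (v ↑ʳ e)) (α ++ β)
    atApex e c rewrite colouredIn-Join-↑ʳ G (Edgeless m) α β e c
                     | colouredIn-nowhere β c
                     | ℕ.+-identityʳ (classSize α c) = base-classes J c

  -- The classes of α are only counted at vertices of K̄_m and those of β only at vertices of G.
  strongOdd⇒joinColouring : IsStrongOddColoring (Join G (Edgeless m)) k (α ++ β) →
                            Fin v → Fin m → JoinColouring G m k α β
  strongOdd⇒joinColouring (proper , odd) x₀ e₀ = record
    { base-strongOdd = α-proper , α-odd
    ; base-classes   = α-classes
    ; apex-classes   = β-classes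
    ; disjoint       = α-β-disjoint
    }
    where
    α-proper : ∀ x y → G x y ≡ true → α x ≢ α y
    α-proper x y with proper (x ↑ˡ m) (y ↑ˡ m)
    ... | p rewrite Join-↑ˡ-↑ˡ G (Edgeless m) x y | lookup-++ˡ α β x | lookup-++ˡ α β y = p

    α-β-disjoint : ∀ x e → α x ≢ β e
    α-β-disjoint x e with proper (x ↑ˡ m) (v ↑ʳ e) (Join-↑ˡ-↑ʳ G (Edgeless m) x e)
    ... | p rewrite lookup-++ˡ α β x | lookup-++ʳ α β e = p

    atBase : ∀ x c → ZeroOrOdd (colouredIn (G x) α c + classSize β c)
    atBase x c = subst ZeroOrOdd (colouredIn-Join-↑ˡ G (Edgeless m) α β x c) (odd (x ↑ˡ m) c)

    α-classes : OddColourClasses α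
    α-classes c with odd (v ↑ʳ e₀) c
    ... | r rewrite colouredIn-Join-↑ʳ G (Edgeless m) α β e₀ c
                  | colouredIn-nowhere β c
                  | ℕ.+-identityʳ (classSize α c) = r

    α-odd : ∀ x → OddColourCounts (G x) α
    α-odd x c with disjoint⇒unused α-β-disjoint c | atBase x c
    ... | inj₁ α-unused | _ = inj₁ (colouredIn-unused (G x) α-unused)
    ... | inj₂ β-unused | r rewrite colouredIn-unused (λ _ → true) β-unused
                                  | ℕ.+-identityʳ (colouredIn (G x) α c) = r

    β-classes : OddColourClasses β
    β-classes c with disjoint⇒unused α-β-disjoint c | atBase x₀ c
    ... | inj₁ α-unused | r rewrite colouredIn-unused (G x₀) α-unused = r
    ... | inj₂ β-unused | _ = inj₁ (colouredIn-unused (λ _ → true) β-unused)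

restrictions-++ : ∀ (col : Fin (v + m) → Fin k) → (col ∘ (_↑ˡ m)) ++ (col ∘ (v ↑ʳ_)) ≗ col
restrictions-++ {v} {m} col = ↑-elim {v} {m} _ (lookup-++ˡ (col ∘ (_↑ˡ m)) (col ∘ (v ↑ʳ_)))
                                             (lookup-++ʳ (col ∘ (_↑ˡ m)) (col ∘ (v ↑ʳ_)))

hasStrongOdd⇒joinColouring : {G : Graph v} → HasStrongOddColoring (Join G (Edgeless m)) k → Fin v → Fin m →
                             Σ[ α ∈ (Fin v → Fin k) ] Σ[ β ∈ (Fin m → Fin k) ] JoinColouring G m k α β
hasStrongOdd⇒joinColouring {v} {m} (col , soc) x₀ e₀ =
  col ∘ (_↑ˡ m) , col ∘ (v ↑ʳ_) ,
  strongOdd⇒joinColouring (isStrongOdd-reflect id (restrictions-++ {v = v} {m = m} col) soc) x₀ e₀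

joinColouring⇒hasStrongOdd : {G : Graph v} {α : Fin v → Fin k} {β : Fin m → Fin k} →
                             JoinColouring G m k α β → HasStrongOddColoring (Join G (Edgeless m)) k
joinColouring⇒hasStrongOdd J = _ , joinColouring⇒strongOdd J

constant-classes : {h : Fin k} → Odd m → OddColourClasses (λ (_ : Fin m) → h)
constant-classes {m = m} {h = h} odd c with h ≟ c
... | yes refl = inj₂ (subst Odd (sym (count-true {m} (λ _ → sameColour-≡ {a = h} refl))) odd)
... | no h≢c   = inj₁ (count-false {m} (λ _ → sameColour-≢ h≢c))

∷-classes : {c₀ : Fin k} {β : Fin m → Fin k} → (∀ e → β e ≢ c₀) →
            OddColourClasses β → OddColourClasses (c₀ ∷ β)
∷-classes {c₀ = c₀} fresh β-classes c with c₀ ≟ c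
... | yes refl rewrite sameColour-≡ {a = c₀} refl | colouredIn-unused (λ _ → true) fresh = inj₂ refl
... | no c₀≢c  rewrite sameColour-≢ c₀≢c = β-classes c

even⇒¬zeroOrOdd : m % 2 ≡ 0 → Fin m → ¬ ZeroOrOdd m
even⇒¬zeroOrOdd {suc m} even _ (inj₂ odd) = ℕ.0≢1+n (trans (sym even) odd)

suc-even⇒odd : ∀ m → suc m % 2 ≡ 0 → Odd m
suc-even⇒odd (suc zero)    _    = refl
suc-even⇒odd (suc (suc m)) even = suc-even⇒odd m even

module _ {G : Graph v} {α : Fin v → Fin k} where

  restrictApex : {β : Fin m → Fin k} → JoinColouring G m k α β → ∀ e → JoinColouring G 1 k α (λ _ → β e)
  restrictApex {β = β} J e = record
    { base-strongOdd = base-strongOdd J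
    ; base-classes   = base-classes J
    ; apex-classes   = constant-classes {m = 1} {h = β e} refl
    ; disjoint       = λ x _ → disjoint J x e
    }

  spreadApex : {β : Fin 1 → Fin k} → Odd m →
               JoinColouring G 1 k α β → JoinColouring G m k α (λ _ → β Fin.zero)
  spreadApex {m} {β} odd W = record
    { base-strongOdd = base-strongOdd W
    ; base-classes   = base-classes W
    ; apex-classes   = constant-classes {m = m} {h = β Fin.zero} odd
    ; disjoint       = λ x _ → disjoint W x Fin.zero
    }

  freshApex : {β : Fin 1 → Fin k} → Odd m → JoinColouring G 1 k α β →
              JoinColouring G (suc m) (suc k) (inject₁ ∘ α) (fromℕ k ∷ (λ _ → inject₁ (β Fin.zero)))
  freshApex {m} {β} odd W = record
    { base-strongOdd = isStrongOdd-injective inject₁-injective (base-strongOdd W)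
    ; base-classes   = oddColourCounts-injective {p = λ _ → true} {col = α} inject₁-injective (base-classes W)
    ; apex-classes   = ∷-classes {β = λ (_ : Fin m) → inject₁ (β Fin.zero)} (λ _ → fromℕ≢inject₁ ∘ sym)
                                 (constant-classes {m = m} {h = inject₁ (β Fin.zero)} odd)
    ; disjoint       = α-β-disjoint
    }
    where
    α-β-disjoint : ∀ x e → inject₁ (α x) ≢ (fromℕ k ∷ (λ _ → inject₁ (β Fin.zero))) e
    α-β-disjoint x Fin.zero    = fromℕ≢inject₁ ∘ sym
    α-β-disjoint x (Fin.suc _) = disjoint W x Fin.zero ∘ inject₁-injective

dropJoinColour : {G : Graph v} {α : Fin v → Fin (suc k)} {β : Fin m → Fin (suc k)} →
                 JoinColouring G m (suc k) α β → ∀ b → (∀ x → α x ≢ b) → (∀ e → β e ≢ b) →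
                 HasStrongOddColoring (Join G (Edgeless m)) k
dropJoinColour {α = α} {β} J b α-unused β-unused = dropUnusedColour (joinColouring⇒strongOdd J) b
  (↑-elim _ (λ x → subst (_≢ b) (sym (lookup-++ˡ α β x)) (α-unused x))
            (λ e → subst (_≢ b) (sym (lookup-++ʳ α β e)) (β-unused e)))

apex-nonconstant : {β : Fin m → Fin k} → m % 2 ≡ 0 → OddColourClasses β →
                   ∀ e₀ → ∃[ e₁ ] β e₁ ≢ β e₀
apex-nonconstant {m} {β = β} even β-classes e₀ with all? (λ e → β e ≟ β e₀)
... | no ¬constant = ¬∀⟶∃¬ m _ (λ e → β e ≟ β e₀) ¬constant
... | yes constant = ⊥-elim (even⇒¬zeroOrOdd even e₀
      (subst ZeroOrOdd (count-true (λ e → sameColour-≡ (constant e))) (β-classes (β e₀))))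

χso-join-edgeless : ∀ (G : Graph (suc v)) → IsChiSo (Join G (Edgeless 1)) k →
  (Odd (suc m) → IsChiSo (Join G (Edgeless (suc m))) k) ×
  (suc m % 2 ≡ 0 → IsChiSo (Join G (Edgeless (suc m))) (suc k))
χso-join-edgeless {v} {k} {m} G (wheel , minimal)
  with _ , _ , W ← hasStrongOdd⇒joinColouring wheel Fin.zero Fin.zero =
  (λ odd → joinColouring⇒hasStrongOdd (spreadApex odd W) , atLeastWheel) ,
  (λ even → joinColouring⇒hasStrongOdd (freshApex (suc-even⇒odd m even) W) , aboveWheel even)
  where

  atLeastWheel : ∀ j → HasStrongOddColoring (Join G (Edgeless (suc m))) j → k ≤ j
  atLeastWheel j join with hasStrongOdd⇒joinColouring join Fin.zero Fin.zero
  ... | _ , _ , J = minimal j (joinColouring⇒hasStrongOdd (restrictApex J Fin.zero))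

  aboveWheel : suc m % 2 ≡ 0 → ∀ j → HasStrongOddColoring (Join G (Edgeless (suc m))) j → suc k ≤ j
  aboveWheel _ zero (col , _) with col Fin.zero
  ... | ()
  aboveWheel even (suc j) join with hasStrongOdd⇒joinColouring join Fin.zero Fin.zero
  ... | _ , β , J with apex-nonconstant even (apex-classes J) Fin.zero
  ... | e₁ , βe₁≢βe₀ = s≤s (minimal j (dropJoinColour (restrictApex J Fin.zero) (β e₁)
                                         (λ x → disjoint J x e₁) (λ _ → βe₁≢βe₀ ∘ sym)))

theorem2 : ∀ (n m k : ℕ) → 3 ≤ n → 1 ≤ m → IsChiSo (Wheel n) k →
    (m % 2 ≡ 1 → IsChiSo (Join (Cycle n) (Edgeless m)) k) ×
    (m % 2 ≡ 0 → IsChiSo (Join (Cycle n) (Edgeless m)) (suc k))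
theorem2 (suc n) (suc m) k _ _ = χso-join-edgeless (Cycle (suc n))
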